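{- For any connected graphs $G$ and $H$ of orders $n_1$ and $n_2$ and radii $r(G)$ and $r(H)$, respectively, $$\gamma_o(G\Box H)\le n_1n_2- 2r(G)r(H).$$
   Context: All graphs are finite and simple. For a graph with vertex set $V$, a vertex $v$ and $S\subseteq V$, let $\delta_S(v)=|N(v)\cap S|$ and $\overline{S}=V\setminus S$. A nonempty set $S\subseteq V$ is a global offensive alliance if $\delta_S(v)\ge \delta_{\overline{S}}(v)+1$ for every $v\in\overline{S}$; $\gamma_o(G)$ is the minimum cardinality of a global offensive alliance of $G$. The radius of a connected graph is the minimum over vertices of their eccentricity (maximum distance to another vertex). $G\Box H$ is the Cartesian product: vertex set $V(G)\times V(H)$, with $(a,b)\sim(c,d)$ iff ($a=c$ and $b\sim d$ in $H$) or ($a\sim c$ in $G$ and $b=d$). -}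

module Defs where

open import Data.Nat using (ℕ; zero; suc; _+_; _*_; _≤_)
open import Data.Bool using (Bool; true; false; _∧_; _∨_)
open import Data.Fin using (Fin; remQuot; _≟_)
open import Data.Fin.Subset using (Subset; _∈_; _∉_; ∁; _∩_; ∣_∣; Nonempty)
open import Data.Vec using (tabulate)
open import Data.Product using (Σ; ∃; _×_; _,_)
open import Relation.Nullary using (does)
open import Relation.Binary.PropositionalEquality using (_≡_)

record Graph (n : ℕ) : Set where
  field
    adj    : Fin n → Fin n → Bool
    sym    : ∀ u v → adj u v ≡ adj v u
    irrefl : ∀ v → adj v v ≡ false
open Graph public

data Walk {n : ℕ} (G : Graph n) : Fin n → Fin n → ℕ → Set where
  here : ∀ {v} → Walk G v v 0
  step : ∀ {u w v k} → adj G u w ≡ true → Walk G w v k → Walk G u v (suc k)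

Connected : ∀ {n} → Graph n → Set
Connected G = ∀ u v → ∃ λ k → Walk G u v k

IsDist : ∀ {n} → Graph n → Fin n → Fin n → ℕ → Set
IsDist G u v d = Walk G u v d × (∀ k → Walk G u v k → d ≤ k)

IsEcc : ∀ {n} → Graph n → Fin n → ℕ → Set
IsEcc G v e = (∀ w d → IsDist G v w d → d ≤ e) × (∃ λ w → IsDist G v w e)

IsRadius : ∀ {n} → Graph n → ℕ → Set
IsRadius G r = (∃ λ v → IsEcc G v r) × (∀ v e → IsEcc G v e → r ≤ e)

-- Cartesian product adjacency on Fin (n₁ * n₂) ≅ Fin n₁ × Fin n₂ (via remQuot).
□-adj : ∀ {n₁ n₂} → Graph n₁ → Graph n₂ → Fin (n₁ * n₂) → Fin (n₁ * n₂) → Bool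
□-adj {n₁} {n₂} G H i j with remQuot n₂ i | remQuot n₂ j
... | a , b | c , d = (does (a ≟ c) ∧ adj H b d) ∨ (adj G a c ∧ does (b ≟ d))

nbhd : ∀ {N} → (Fin N → Fin N → Bool) → Fin N → Subset N
nbhd a v = tabulate (a v)

δ : ∀ {N} → (Fin N → Fin N → Bool) → Subset N → Fin N → ℕ
δ a S v = ∣ nbhd a v ∩ S ∣

IsGOA : ∀ {N} → (Fin N → Fin N → Bool) → Subset N → Set
IsGOA a S = Nonempty S × (∀ v → v ∉ S → suc (δ a (∁ S) v) ≤ δ a S v)

-- Fix a centre c of G, of eccentricity r = rad G, and sort the vertices into the layers
-- D = dist c = 0, 1, …, r.  Pick c in layer 0, a vertex t in layer r and, in every layer
-- 0 < i < r, two vertices which, if adjacent, both have a neighbour in layer i + 1.  Such a pair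
-- exists: if the only vertex z of layer i with a neighbour in layer i + 1 were adjacent to all
-- other vertices of the layer, the successor of c on a shortest path to z would have eccentricity
-- less than r.  Colouring the picked vertices by the parity of their layer gives two colour
-- classes of at least r vertices each, and a coloured vertex has at most one neighbour of its
-- own colour (its partner in the layer), in which case it also has a predecessor and a
-- successor, both of the other parity.  In G □ H the pairs (a , b) with a and b of the same
-- colour are at least 2 rG rH in number, and the same-coloured neighbours of such a pair are
-- those of a in G plus those of b in H, each strictly outnumbered; so the complement of these
-- pairs is a global offensive alliance.

module Submission where

open import Defs hiding (sym)
open import Data.Nat as ℕ using (ℕ; zero; suc; _+_; _*_; _∸_; _≤_; _<_; _≤?_; _<?_; z≤n; s≤s; z<s)
open import Data.Nat.Properties
  using ( +-*-semiring; +-assoc; *-assoc; +-identityʳ; +-suc; +-mono-≤; +-monoʳ-≤; +-mono-<-≤; *-mono-≤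
        ; ≤-refl; ≤-reflexive; ≤-trans; ≤-antisym; ≤-pred; ≮⇒≥; <⇒≤; ≰⇒>; <⇒≢; <⇒≱; <-cmp
        ; n≤1+n; n<1+n; m<n⇒m<1+n; m≤n⇒m<n∨m≡n; m≤n⇒∃[o]m+o≡n; m∸n+n≡m; suc-injective; 1+n≢n
        ; module ≤-Reasoning )
open import Data.Bool as Bool using (Bool; true; false; not; _∧_; _∨_)
open import Data.Bool.Properties using (∨-identityʳ; not-involutive; not-injective; ¬-not)
open import Data.Maybe using (Maybe; just; nothing)
open import Data.Fin using (Fin; zero; suc; toℕ; _↑ˡ_; _↑ʳ_; combine; remQuot; _≟_)
open import Data.Fin.Properties as Finₚ using (remQuot-combine; combine-remQuot; 0≢1+n; any?; toℕ-injective; toℕ<n)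
open import Data.Fin.Subset using (Subset; _∈_; _∉_; _⊆_; ∣_∣; ∁; _∩_; _-_; ⁅_⁆; Nonempty; Empty)
open import Data.Fin.Subset.Properties
  using ( x∈p⇒∣p-x∣<∣p∣; x∈p∧x≢y⇒x∈p-y; p⊆q⇒∣p∣≤∣q∣; ∣⁅x⁆∣≡1; ∣⊥∣≡0; Empty-unique; nonempty?
        ; ∣∁p∣≡n∸∣p∣; ∣p∣≤n; x∉∁p⇒x∈p; x∉p⇒x∈∁p; x∈p∩q⁺; x∈p∩q⁻; x∈⁅x⁆; _∈?_ )
open import Data.Vec using ([]; _∷_; tabulate)
open import Data.Vec.Properties using (lookup∘tabulate; tabulate-cong; tabulate-∘; lookup⇒[]=; []=⇒lookup)
open import Data.Product using (∃; ∃₂; _×_; _,_; proj₁; proj₂; uncurry)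
open import Data.Sum using (_⊎_; inj₁; inj₂; [_,_]′)
open import Function using (_∘_)
open import Relation.Nullary using (Dec; does; yes; no; ¬_; contradiction)
open import Relation.Nullary.Decidable using (_×-dec_; _⊎-dec_; _→-dec_; ¬?)
open import Relation.Binary using (tri<; tri≈; tri>)
open import Relation.Binary.PropositionalEquality
  using (_≡_; _≢_; refl; sym; trans; cong; cong₂; subst; module ≡-Reasoning)
open import Algebra.Properties.Semiring.Sum +-*-semiring
  using (sum; sum-cong-≗; ∑-distrib-+; *-distribʳ-sum; sum-replicate-zero)

-- Counting elements of subsets

iverson : Bool → ℕ
iverson true  = 1
iverson false = 0

∣tabulate∣ : ∀ {n} (f : Fin n → Bool) → ∣ tabulate f ∣ ≡ sum (iverson ∘ f)
∣tabulate∣ {zero}  f = refl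
∣tabulate∣ {suc n} f with f zero
... | true  = cong suc (∣tabulate∣ (f ∘ suc))
... | false = ∣tabulate∣ (f ∘ suc)

tabulate-∩ : ∀ {n} (f g : Fin n → Bool) → tabulate f ∩ tabulate g ≡ tabulate (λ i → f i ∧ g i)
tabulate-∩ {zero}  f g = refl
tabulate-∩ {suc n} f g = cong (f zero ∧ g zero ∷_) (tabulate-∩ (f ∘ suc) (g ∘ suc))

∁-tabulate : ∀ {n} (f : Fin n → Bool) → ∁ (tabulate f) ≡ tabulate (not ∘ f)
∁-tabulate f = sym (tabulate-∘ not f)

∁-involutive : ∀ {n} (p : Subset n) → ∁ (∁ p) ≡ p
∁-involutive []      = refl
∁-involutive (x ∷ p) = cong₂ _∷_ (not-involutive x) (∁-involutive p)

∈-tabulate⁺ : ∀ {n} {f : Fin n → Bool} {x} → f x ≡ true → x ∈ tabulate f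
∈-tabulate⁺ {f = f} {x} fx = lookup⇒[]= x (tabulate f) (trans (lookup∘tabulate f x) fx)

∈-tabulate⁻ : ∀ {n} {f : Fin n → Bool} {x} → x ∈ tabulate f → f x ≡ true
∈-tabulate⁻ {f = f} {x} x∈ = trans (sym (lookup∘tabulate f x)) ([]=⇒lookup x∈)

∣tabulate∣-split : ∀ {n} (f g h : Fin n → Bool) → (∀ i → iverson (f i) ≡ iverson (g i) + iverson (h i)) →
  ∣ tabulate f ∣ ≡ ∣ tabulate g ∣ + ∣ tabulate h ∣
∣tabulate∣-split f g h split = begin
  ∣ tabulate f ∣                                  ≡⟨ ∣tabulate∣ f ⟩
  sum (iverson ∘ f)                               ≡⟨ sum-cong-≗ split ⟩
  sum (λ i → iverson (g i) + iverson (h i))       ≡⟨ ∑-distrib-+ (iverson ∘ g) (iverson ∘ h) ⟩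
  sum (iverson ∘ g) + sum (iverson ∘ h)           ≡⟨ cong₂ _+_ (∣tabulate∣ g) (∣tabulate∣ h) ⟨
  ∣ tabulate g ∣ + ∣ tabulate h ∣                  ∎
  where open ≡-Reasoning

∣tabulate-∧∣ : ∀ {n} b (g : Fin n → Bool) → ∣ tabulate (λ i → b ∧ g i) ∣ ≡ iverson b * ∣ tabulate g ∣
∣tabulate-∧∣ true  g = sym (+-identityʳ ∣ tabulate g ∣)
∣tabulate-∧∣ {n} false g = trans (∣tabulate∣ {n} (λ _ → false)) (sum-replicate-zero n)

sum-↑ : ∀ m {n} (f : Fin (m + n) → ℕ) → sum f ≡ sum (f ∘ (_↑ˡ n)) + sum (f ∘ (m ↑ʳ_))
sum-↑ zero    f = refl
sum-↑ (suc m) f = trans (cong (f zero +_) (sum-↑ m (f ∘ suc))) (sym (+-assoc (f zero) _ _))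

sum-combine : ∀ m n (f : Fin (m * n) → ℕ) → sum f ≡ sum {m} (λ a → sum {n} (λ b → f (combine a b)))
sum-combine zero    n f = refl
sum-combine (suc m) n f =
  trans (sum-↑ n {m * n} f)
        (cong (sum {n} (λ b → f (combine {suc m} zero b)) +_) (sum-combine m n (λ i → f (n ↑ʳ i))))

∑-≟ : ∀ {n} (x : Fin n) (g : Fin n → ℕ) → sum (λ a → iverson (does (x ≟ a)) * g a) ≡ g x
∑-≟ {suc n} zero    g = trans (cong₂ _+_ (+-identityʳ (g zero)) (sum-replicate-zero n)) (+-identityʳ (g zero))
∑-≟ {suc n} (suc x) g = ∑-≟ x (g ∘ suc)

iverson-∧ : ∀ a b → iverson (a ∧ b) ≡ iverson a * iverson b
iverson-∧ true  b = sym (+-identityʳ (iverson b))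
iverson-∧ false b = refl

∣tabulate-≟∧∣ : ∀ {n} (y : Fin n) (f : Fin n → Bool) → ∣ tabulate (λ b → does (y ≟ b) ∧ f b) ∣ ≡ iverson (f y)
∣tabulate-≟∧∣ y f = begin
  ∣ tabulate (λ b → does (y ≟ b) ∧ f b) ∣              ≡⟨ ∣tabulate∣ (λ b → does (y ≟ b) ∧ f b) ⟩
  sum (λ b → iverson (does (y ≟ b) ∧ f b))           ≡⟨ sum-cong-≗ (λ b → iverson-∧ (does (y ≟ b)) (f b)) ⟩
  sum (λ b → iverson (does (y ≟ b)) * iverson (f b)) ≡⟨ ∑-≟ y (iverson ∘ f) ⟩
  iverson (f y)                                      ∎
  where open ≡-Reasoning

injection⇒≤∣p∣ : ∀ {m n} (p : Subset n) (f : Fin m → Fin n) →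
  (∀ i j → f i ≡ f j → i ≡ j) → (∀ i → f i ∈ p) → m ≤ ∣ p ∣
injection⇒≤∣p∣ {zero}  p f inj f∈p = z≤n
injection⇒≤∣p∣ {suc m} p f inj f∈p =
  ≤-trans (s≤s (injection⇒≤∣p∣ (p - f zero) (f ∘ suc) inj′ f∈p-f₀)) (x∈p⇒∣p-x∣<∣p∣ (f∈p zero))
  where
  inj′ : ∀ i j → f (suc i) ≡ f (suc j) → i ≡ j
  inj′ i j e = Finₚ.suc-injective (inj (suc i) (suc j) e)
  f∈p-f₀ : ∀ i → f (suc i) ∈ p - f zero
  f∈p-f₀ i = x∈p∧x≢y⇒x∈p-y (f∈p (suc i)) (λ e → 0≢1+n (sym (inj (suc i) zero e)))

x∈p⇒1≤∣p∣ : ∀ {n x} {p : Subset n} → x ∈ p → 1 ≤ ∣ p ∣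
x∈p⇒1≤∣p∣ x∈p = ≤-trans (s≤s z≤n) (x∈p⇒∣p-x∣<∣p∣ x∈p)

x,y∈p⇒2≤∣p∣ : ∀ {n x y} {p : Subset n} → x ∈ p → y ∈ p → x ≢ y → 2 ≤ ∣ p ∣
x,y∈p⇒2≤∣p∣ x∈p y∈p x≢y =
  ≤-trans (s≤s (x∈p⇒1≤∣p∣ (x∈p∧x≢y⇒x∈p-y y∈p (x≢y ∘ sym)))) (x∈p⇒∣p-x∣<∣p∣ x∈p)

⊆⁅x⁆⇒∣p∣≤1 : ∀ {n x} {p : Subset n} → p ⊆ ⁅ x ⁆ → ∣ p ∣ ≤ 1
⊆⁅x⁆⇒∣p∣≤1 {x = x} p⊆⁅x⁆ = ≤-trans (p⊆q⇒∣p∣≤∣q∣ p⊆⁅x⁆) (≤-reflexive (∣⁅x⁆∣≡1 x))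

Empty⇒∣p∣≡0 : ∀ {n} {p : Subset n} → Empty p → ∣ p ∣ ≡ 0
Empty⇒∣p∣≡0 {n} empty = trans (cong ∣_∣ (Empty-unique empty)) (∣⊥∣≡0 n)

1≤∣p∣⇒Nonempty : ∀ {n} {p : Subset n} → 1 ≤ ∣ p ∣ → Nonempty p
1≤∣p∣⇒Nonempty {p = p} 1≤∣p∣ with nonempty? p
... | yes ne    = ne
... | no  empty = contradiction (subst (1 ≤_) (Empty⇒∣p∣≡0 empty) 1≤∣p∣) λ ()

-- Subsets of a product and the Cartesian product

module _ {n₁ n₂ : ℕ} where

  -- The subset of pairs satisfying P, pairs being encoded by combine/remQuot as in □-adj.
  ⟦_⟧ : (Fin n₁ → Fin n₂ → Bool) → Subset (n₁ * n₂)
  ⟦ P ⟧ = tabulate (λ i → uncurry P (remQuot n₂ i))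

  ∣⟦⟧∣ : ∀ P → ∣ ⟦ P ⟧ ∣ ≡ sum {n₁} (λ a → ∣ tabulate (P a) ∣)
  ∣⟦⟧∣ P = begin
    ∣ ⟦ P ⟧ ∣                                                          ≡⟨ ∣tabulate∣ (uncurry P ∘ remQuot n₂) ⟩
    sum (iverson ∘ uncurry P ∘ remQuot n₂)                            ≡⟨ sum-combine n₁ n₂ _ ⟩
    sum {n₁} (λ a → sum {n₂} (λ b → iverson (uncurry P (remQuot n₂ (combine a b)))))
      ≡⟨ sum-cong-≗ (λ a → sum-cong-≗ (λ b → cong (iverson ∘ uncurry P) (remQuot-combine a b))) ⟩
    sum {n₁} (λ a → sum {n₂} (λ b → iverson (P a b)))                 ≡⟨ sum-cong-≗ (∣tabulate∣ ∘ P) ⟨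
    sum {n₁} (λ a → ∣ tabulate (P a) ∣)                                ∎
    where open ≡-Reasoning

  ∣⟦∧⟧∣ : ∀ (f : Fin n₁ → Bool) (g : Fin n₂ → Bool) → ∣ ⟦ (λ a b → f a ∧ g b) ⟧ ∣ ≡ ∣ tabulate f ∣ * ∣ tabulate g ∣
  ∣⟦∧⟧∣ f g = begin
    ∣ ⟦ (λ a b → f a ∧ g b) ⟧ ∣                    ≡⟨ ∣⟦⟧∣ (λ a b → f a ∧ g b) ⟩
    sum (λ a → ∣ tabulate (λ b → f a ∧ g b) ∣)     ≡⟨ sum-cong-≗ (λ a → ∣tabulate-∧∣ (f a) g) ⟩
    sum (λ a → iverson (f a) * ∣ tabulate g ∣)     ≡⟨ *-distribʳ-sum ∣ tabulate g ∣ (iverson ∘ f) ⟨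
    sum (iverson ∘ f) * ∣ tabulate g ∣             ≡⟨ cong (_* ∣ tabulate g ∣) (∣tabulate∣ f) ⟨
    ∣ tabulate f ∣ * ∣ tabulate g ∣                 ∎
    where open ≡-Reasoning

δ-tabulate : ∀ {n} (a : Fin n → Fin n → Bool) (f : Fin n → Bool) v →
  δ a (tabulate f) v ≡ ∣ tabulate (λ u → a v u ∧ f u) ∣
δ-tabulate a f v = cong ∣_∣ (tabulate-∩ (a v) f)

module _ {n₁ n₂} (G : Graph n₁) (H : Graph n₂) where

  □-adj′ : Fin n₁ → Fin n₂ → Fin n₁ → Fin n₂ → Bool
  □-adj′ x y a b = (does (x ≟ a) ∧ adj H y b) ∨ (adj G x a ∧ does (y ≟ b))

  □-adj-remQuot : ∀ i j → □-adj G H i j ≡ uncurry (uncurry □-adj′ (remQuot n₂ i)) (remQuot n₂ j)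
  □-adj-remQuot i j with remQuot {n₁} n₂ i | remQuot {n₁} n₂ j
  ... | _ , _ | _ , _ = refl

  ∣□-row∣ : ∀ x y a (P : Fin n₁ → Fin n₂ → Bool) →
    ∣ tabulate (λ b → □-adj′ x y a b ∧ P a b) ∣ ≡
    iverson (does (x ≟ a)) * ∣ tabulate (λ b → adj H y b ∧ P x b) ∣ + iverson (adj G x a ∧ P a y)
  ∣□-row∣ x y a P with x ≟ a
  ... | yes refl rewrite irrefl G x =
    trans (cong ∣_∣ (tabulate-cong (λ b → cong (_∧ P x b) (∨-identityʳ (adj H y b)))))
          (sym (trans (+-identityʳ _) (+-identityʳ _)))
  ... | no _ with adj G x a
  ...   | true  = ∣tabulate-≟∧∣ y (P a)
  ...   | false = ∣tabulate-∧∣ false (P a)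

  δ-□ : ∀ (P : Fin n₁ → Fin n₂ → Bool) x y →
    δ (□-adj G H) ⟦ P ⟧ (combine x y) ≡ δ (adj H) (tabulate (P x)) y + δ (adj G) (tabulate (λ a → P a y)) x
  δ-□ P x y = begin
    δ (□-adj G H) ⟦ P ⟧ (combine x y)
      ≡⟨ δ-tabulate (□-adj G H) _ (combine x y) ⟩
    ∣ tabulate (λ j → □-adj G H (combine x y) j ∧ uncurry P (remQuot n₂ j)) ∣
      ≡⟨ cong ∣_∣ (tabulate-cong (λ j → cong (_∧ uncurry P (remQuot n₂ j))
           (trans (□-adj-remQuot (combine x y) j)
                  (cong (λ xy → uncurry (uncurry □-adj′ xy) (remQuot n₂ j)) (remQuot-combine x y))))) ⟩
    ∣ ⟦ (λ a b → □-adj′ x y a b ∧ P a b) ⟧ ∣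
      ≡⟨ ∣⟦⟧∣ {n₁} (λ a b → □-adj′ x y a b ∧ P a b) ⟩
    sum (λ a → ∣ tabulate (λ b → □-adj′ x y a b ∧ P a b) ∣)
      ≡⟨ sum-cong-≗ (λ a → ∣□-row∣ x y a P) ⟩
    sum (λ a → iverson (does (x ≟ a)) * N + iverson (adj G x a ∧ P a y))
      ≡⟨ ∑-distrib-+ (λ a → iverson (does (x ≟ a)) * N) (λ a → iverson (adj G x a ∧ P a y)) ⟩
    sum (λ a → iverson (does (x ≟ a)) * N) + sum (λ a → iverson (adj G x a ∧ P a y))
      ≡⟨ cong₂ _+_ (∑-≟ x (λ _ → N)) (sym (∣tabulate∣ (λ a → adj G x a ∧ P a y))) ⟩
    N + ∣ tabulate (λ a → adj G x a ∧ P a y) ∣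
      ≡⟨ cong₂ _+_ (δ-tabulate (adj H) (P x) y) (δ-tabulate (adj G) (λ a → P a y) x) ⟨
    δ (adj H) (tabulate (P x)) y + δ (adj G) (tabulate (λ a → P a y)) x
      ∎
    where
    open ≡-Reasoning
    N = ∣ tabulate (λ b → adj H y b ∧ P x b) ∣

-- Partial 2-colourings

-- Uncoloured vertices (nothing) agree with no colour, not even with each other.
_≈ᶜ_ : Maybe Bool → Maybe Bool → Bool
just p ≈ᶜ just q = does (p Bool.≟ q)
_      ≈ᶜ _      = false

≈ᶜ-sym : ∀ u v → u ≈ᶜ v ≡ v ≈ᶜ u
≈ᶜ-sym (just false) (just false) = refl
≈ᶜ-sym (just false) (just true)  = refl
≈ᶜ-sym (just true)  (just false) = refl
≈ᶜ-sym (just true)  (just true)  = refl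
≈ᶜ-sym (just _)     nothing      = refl
≈ᶜ-sym nothing      (just _)     = refl
≈ᶜ-sym nothing      nothing      = refl

≈ᶜ-refl : ∀ p → just p ≈ᶜ just p ≡ true
≈ᶜ-refl false = refl
≈ᶜ-refl true  = refl

≈ᶜ⇒just : ∀ u v → u ≈ᶜ v ≡ true → ∃ λ p → u ≡ just p × v ≡ just p
≈ᶜ⇒just (just false) (just false) _ = false , refl , refl
≈ᶜ⇒just (just true)  (just true)  _ = true , refl , refl

iverson-≈ᶜ : ∀ u v →
  iverson (u ≈ᶜ v) ≡ iverson (u ≈ᶜ just false ∧ v ≈ᶜ just false) + iverson (u ≈ᶜ just true ∧ v ≈ᶜ just true)
iverson-≈ᶜ (just false) (just false) = refl
iverson-≈ᶜ (just false) (just true)  = refl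
iverson-≈ᶜ (just true)  (just false) = refl
iverson-≈ᶜ (just true)  (just true)  = refl
iverson-≈ᶜ (just false) nothing      = refl
iverson-≈ᶜ (just true)  nothing      = refl
iverson-≈ᶜ nothing      _            = refl

hasColour : ∀ {n} → (Fin n → Maybe Bool) → Bool → Fin n → Bool
hasColour colour p a = colour a ≈ᶜ just p

hasColour⇒≡just : ∀ {n} (colour : Fin n → Maybe Bool) {p a} → hasColour colour p a ≡ true → colour a ≡ just p
hasColour⇒≡just colour {p} {a} e with ≈ᶜ⇒just (colour a) (just p) e
... | _ , ca≡ , refl = ca≡

≡just⇒hasColour : ∀ {n} (colour : Fin n → Maybe Bool) {p a} → colour a ≡ just p → hasColour colour p a ≡ true
≡just⇒hasColour colour {p} ca≡ = trans (cong (_≈ᶜ just p) ca≡) (≈ᶜ-refl p)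

colourClass : ∀ {n} → (Fin n → Maybe Bool) → Bool → Subset n
colourClass colour p = tabulate (hasColour colour p)

record OffensiveColouring {n} (G : Graph n) (r : ℕ) : Set where
  field
    colour      : Fin n → Maybe Bool
    class-size  : ∀ p → r ≤ ∣ colourClass colour p ∣
    outnumbered : ∀ x p → colour x ≡ just p →
                  suc (δ (adj G) (colourClass colour p) x) ≤ δ (adj G) (∁ (colourClass colour p)) x

module _ {n₁ n₂} {G : Graph n₁} {H : Graph n₂} {rG rH}
         (κ : OffensiveColouring G rG) (μ : OffensiveColouring H rH) where

  open OffensiveColouring

  Cκ : Bool → Subset n₁
  Cκ = colourClass (colour κ)

  Cμ : Bool → Subset n₂
  Cμ = colourClass (colour μ)

  sameColour : Subset (n₁ * n₂)
  sameColour = ⟦ (λ a b → colour κ a ≈ᶜ colour μ b) ⟧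

  2rGrH≤∣sameColour∣ : 2 * rG * rH ≤ ∣ sameColour ∣
  2rGrH≤∣sameColour∣ = begin
    2 * rG * rH
      ≡⟨ trans (*-assoc 2 rG rH) (cong (rG * rH +_) (+-identityʳ (rG * rH))) ⟩
    rG * rH + rG * rH
      ≤⟨ +-mono-≤ (*-mono-≤ (class-size κ false) (class-size μ false))
                  (*-mono-≤ (class-size κ true) (class-size μ true)) ⟩
    ∣ Cκ false ∣ * ∣ Cμ false ∣ + ∣ Cκ true ∣ * ∣ Cμ true ∣
      ≡⟨ cong₂ _+_ (∣⟦∧⟧∣ (hasColour (colour κ) false) (hasColour (colour μ) false))
                   (∣⟦∧⟧∣ (hasColour (colour κ) true) (hasColour (colour μ) true)) ⟨
    ∣ ⟦ bothColoured false ⟧ ∣ + ∣ ⟦ bothColoured true ⟧ ∣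
      ≡⟨ ∣tabulate∣-split _ _ _ (λ i → iverson-≈ᶜ (colour κ (proj₁ (remQuot {n₁} n₂ i)))
                                                   (colour μ (proj₂ (remQuot {n₁} n₂ i)))) ⟨
    ∣ sameColour ∣
      ∎
    where
    open ≤-Reasoning
    bothColoured : Bool → Fin n₁ → Fin n₂ → Bool
    bothColoured p a b = hasColour (colour κ) p a ∧ hasColour (colour μ) p b

  S : Subset (n₁ * n₂)
  S = ∁ sameColour

  ∣S∣+2rGrH≤n₁n₂ : ∣ S ∣ + 2 * rG * rH ≤ n₁ * n₂
  ∣S∣+2rGrH≤n₁n₂ = begin
    ∣ S ∣ + 2 * rG * rH                       ≤⟨ +-monoʳ-≤ ∣ S ∣ 2rGrH≤∣sameColour∣ ⟩
    ∣ S ∣ + ∣ sameColour ∣                    ≡⟨ cong (_+ ∣ sameColour ∣) (∣∁p∣≡n∸∣p∣ sameColour) ⟩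
    n₁ * n₂ ∸ ∣ sameColour ∣ + ∣ sameColour ∣ ≡⟨ m∸n+n≡m (∣p∣≤n sameColour) ⟩
    n₁ * n₂                                   ∎
    where open ≤-Reasoning

  module _ (x : Fin n₁) (y : Fin n₂) (p : Bool) (κx : colour κ x ≡ just p) (μy : colour μ y ≡ just p) where

    row≡Cμ : tabulate (λ b → colour κ x ≈ᶜ colour μ b) ≡ Cμ p
    row≡Cμ = tabulate-cong (λ b → trans (cong (_≈ᶜ colour μ b) κx) (≈ᶜ-sym (just p) (colour μ b)))

    column≡Cκ : tabulate (λ a → colour κ a ≈ᶜ colour μ y) ≡ Cκ p
    column≡Cκ = tabulate-cong (λ a → cong (colour κ a ≈ᶜ_) μy)

    δ-sameColour : δ (□-adj G H) sameColour (combine x y) ≡ δ (adj H) (Cμ p) y + δ (adj G) (Cκ p) x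
    δ-sameColour = trans (δ-□ G H _ x y)
      (cong₂ _+_ (cong (λ q → δ (adj H) q y) row≡Cμ) (cong (λ q → δ (adj G) q x) column≡Cκ))

    δ-S : δ (□-adj G H) S (combine x y) ≡ δ (adj H) (∁ (Cμ p)) y + δ (adj G) (∁ (Cκ p)) x
    δ-S = begin
      δ (□-adj G H) S (combine x y)
        ≡⟨ cong (λ q → δ (□-adj G H) q (combine x y)) (∁-tabulate _) ⟩
      δ (□-adj G H) ⟦ (λ a b → not (colour κ a ≈ᶜ colour μ b)) ⟧ (combine x y)
        ≡⟨ δ-□ G H _ x y ⟩
      δ (adj H) (tabulate (λ b → not (colour κ x ≈ᶜ colour μ b))) y
        + δ (adj G) (tabulate (λ a → not (colour κ a ≈ᶜ colour μ y))) x
        ≡⟨ cong₂ _+_ (cong (λ q → δ (adj H) q y) (trans (sym (∁-tabulate _)) (cong ∁ row≡Cμ)))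
                     (cong (λ q → δ (adj G) q x) (trans (sym (∁-tabulate _)) (cong ∁ column≡Cκ))) ⟩
      δ (adj H) (∁ (Cμ p)) y + δ (adj G) (∁ (Cκ p)) x
        ∎
      where open ≡-Reasoning

  combine∈sameColour : ∀ {x y} → combine x y ∈ sameColour → colour κ x ≈ᶜ colour μ y ≡ true
  combine∈sameColour {x} {y} xy∈ =
    trans (cong (λ ab → colour κ (proj₁ ab) ≈ᶜ colour μ (proj₂ ab)) (sym (remQuot-combine x y))) (∈-tabulate⁻ xy∈)

  S-outnumbers-combine : ∀ x y → combine x y ∉ S →
    suc (δ (□-adj G H) (∁ S) (combine x y)) ≤ δ (□-adj G H) S (combine x y)
  S-outnumbers-combine x y xy∉S with ≈ᶜ⇒just (colour κ x) (colour μ y) (combine∈sameColour (x∉∁p⇒x∈p xy∉S))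
  ... | p , κx , μy = begin-strict
    δ (□-adj G H) (∁ S) (combine x y)
      ≡⟨ cong (λ q → δ (□-adj G H) q (combine x y)) (∁-involutive sameColour) ⟩
    δ (□-adj G H) sameColour (combine x y)
      ≡⟨ δ-sameColour x y p κx μy ⟩
    δ (adj H) (Cμ p) y + δ (adj G) (Cκ p) x
      <⟨ +-mono-<-≤ (outnumbered μ y p μy) (≤-trans (n≤1+n _) (outnumbered κ x p κx)) ⟩
    δ (adj H) (∁ (Cμ p)) y + δ (adj G) (∁ (Cκ p)) x
      ≡⟨ δ-S x y p κx μy ⟨
    δ (□-adj G H) S (combine x y)
      ∎
    where open ≤-Reasoning

  S-outnumbers : ∀ v → v ∉ S → suc (δ (□-adj G H) (∁ S) v) ≤ δ (□-adj G H) S v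
  S-outnumbers v = subst (λ w → w ∉ S → suc (δ (□-adj G H) (∁ S) w) ≤ δ (□-adj G H) S w) (combine-remQuot {n₁} n₂ v)
    (S-outnumbers-combine (proj₁ (remQuot {n₁} n₂ v)) (proj₂ (remQuot {n₁} n₂ v)))

  S-nonempty : Fin (n₁ * n₂) → Nonempty S
  S-nonempty v with v ∈? S
  ... | yes v∈S = v , v∈S
  ... | no  v∉S =
    let (w , w∈N∩S) = 1≤∣p∣⇒Nonempty (≤-trans (s≤s z≤n) (S-outnumbers v v∉S))
    in w , proj₂ (x∈p∩q⁻ (nbhd (□-adj G H) v) S w∈N∩S)

  offensiveColouring⇒GOA : Fin (n₁ * n₂) →
    ∃ λ (S : Subset (n₁ * n₂)) → IsGOA (□-adj G H) S × ∣ S ∣ + 2 * rG * rH ≤ n₁ * n₂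
  offensiveColouring⇒GOA v = S , (S-nonempty v , S-outnumbers) , ∣S∣+2rGrH≤n₁n₂

-- Walks and distances

module _ {n} (G : Graph n) where

  _▷_ : ∀ {u v w k} → Walk G u v k → adj G v w ≡ true → Walk G u w (suc k)
  here     ▷ e = step e here
  step e′ W ▷ e = step e′ (W ▷ e)

  unsnoc : ∀ {u v k} → Walk G u v (suc k) → ∃ λ w → Walk G u w k × adj G w v ≡ true
  unsnoc (step e here)          = _ , here , e
  unsnoc (step e (step e′ W)) with unsnoc (step e′ W)
  ... | w , W′ , e″ = w , step e W′ , e″

  _++ʷ_ : ∀ {u v w k l} → Walk G u v k → Walk G v w l → Walk G u w (k + l)
  here     ++ʷ W′ = W′
  step e W ++ʷ W′ = step e (W ++ʷ W′)

  walk-length-0 : ∀ {u v} → Walk G u v 0 → u ≡ v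
  walk-length-0 here = refl

  walk? : ∀ k u v → Dec (Walk G u v k)
  walk? zero u v with u ≟ v
  ... | yes refl = yes here
  ... | no  u≢v  = no (u≢v ∘ walk-length-0)
  walk? (suc k) u v with any? (λ w → (adj G u w Bool.≟ true) ×-dec walk? k w v)
  ... | yes (w , e , W) = yes (step e W)
  ... | no  none        = no λ { (step e W) → none (_ , e , W) }

module _ {P : ℕ → Set} (P? : ∀ k → Dec (P k)) where

  private
    firstUpTo : ∀ k → (∃ λ m → P m × ∀ j → j < m → ¬ P j) ⊎ (∀ j → j ≤ k → ¬ P j)
    firstUpTo zero with P? 0
    ... | yes p0 = inj₁ (0 , p0 , λ _ ())
    ... | no ¬p0 = inj₂ λ { zero _ → ¬p0 }
    firstUpTo (suc k) with firstUpTo k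
    ... | inj₁ found = inj₁ found
    ... | inj₂ none with P? (suc k)
    ...   | yes pk = inj₁ (suc k , pk , λ j j<1+k → none j (≤-pred j<1+k))
    ...   | no ¬pk = inj₂ λ j j≤1+k →
      [ (λ j<1+k → none j (≤-pred j<1+k)) , (λ { refl → ¬pk }) ]′ (m≤n⇒m<n∨m≡n j≤1+k)

  least : ∀ k → P k → ∃ λ m → P m × ∀ j → P j → m ≤ j
  least k pk with firstUpTo k
  ... | inj₁ (m , pm , below) = m , pm , λ j pj → ≮⇒≥ (λ j<m → below j j<m pj)
  ... | inj₂ none             = contradiction pk (none k ≤-refl)

argmax : ∀ {n} (f : Fin n → ℕ) → Fin n → ∃ λ a → ∀ b → f b ≤ f a
argmax {suc zero}    f _ = zero , λ { zero → ≤-refl }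
argmax {suc (suc n)} f _ with argmax (f ∘ suc) zero
... | a , max with f zero ≤? f (suc a)
...   | yes f0≤ = suc a , λ { zero → f0≤ ; (suc b) → max b }
...   | no  f0≰ = zero  , λ { zero → ≤-refl ; (suc b) → ≤-trans (max b) (<⇒≤ (≰⇒> f0≰)) }

module Distance {n} (G : Graph n) (conn : Connected G) where

  private
    shortest : ∀ u v → ∃ λ d → Walk G u v d × ∀ k → Walk G u v k → d ≤ k
    shortest u v = least (λ k → walk? G k u v) (proj₁ (conn u v)) (proj₂ (conn u v))

  dist : Fin n → Fin n → ℕ
  dist u v = proj₁ (shortest u v)

  dist-isDist : ∀ u v → IsDist G u v (dist u v)
  dist-isDist u v = proj₂ (shortest u v)

  shortestWalk : ∀ u v → Walk G u v (dist u v)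
  shortestWalk u v = proj₁ (dist-isDist u v)

  dist-minimal : ∀ {u v k} → Walk G u v k → dist u v ≤ k
  dist-minimal {u} {v} = proj₂ (dist-isDist u v) _

  IsDist⇒≡dist : ∀ {u v d} → IsDist G u v d → d ≡ dist u v
  IsDist⇒≡dist {u} {v} (W , minimal) = ≤-antisym (minimal _ (shortestWalk u v)) (dist-minimal W)

  dist-refl : ∀ u → dist u u ≡ 0
  dist-refl u = ≤-antisym (dist-minimal here) z≤n

  dist≡0 : ∀ {u v} → dist u v ≡ 0 → u ≡ v
  dist≡0 {u} {v} d≡0 = walk-length-0 G (subst (Walk G u v) d≡0 (shortestWalk u v))

  dist-adj : ∀ u {x y} → adj G x y ≡ true → dist u y ≤ suc (dist u x)
  dist-adj u {x} e = dist-minimal (_▷_ G (shortestWalk u x) e)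

  dist-pred : ∀ u {x i} → dist u x ≡ suc i → ∃ λ y → adj G y x ≡ true × dist u y ≡ i
  dist-pred u {x} d≡1+i with unsnoc G (subst (Walk G u x) d≡1+i (shortestWalk u x))
  ... | y , W , e = y , e , ≤-antisym (dist-minimal W) (≤-pred (subst (_≤ suc (dist u y)) d≡1+i (dist-adj u e)))

  farVertex : ∀ {r} → IsRadius G r → ∀ u → ∃ λ w → r ≤ dist u w
  farVertex (_ , r≤ecc) u with argmax (dist u) u
  ... | w , max = w , r≤ecc u (dist u w) (isEcc , w , dist-isDist u w)
    where
    isEcc : ∀ v d → IsDist G u v d → d ≤ dist u w
    isEcc v d isDist = subst (_≤ dist u w) (sym (IsDist⇒≡dist isDist)) (max v)

-- Colouring the breadth-first layers of a centre by parity

parity : ℕ → Bool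
parity zero    = false
parity (suc k) = Bool.not (parity k)

parity-injective-adjacent : ∀ {a b} → a ≤ suc b → b ≤ suc a → parity a ≡ parity b → a ≡ b
parity-injective-adjacent {zero}  {zero}        _         _         _ = refl
parity-injective-adjacent {zero}  {suc zero}    _         _         ()
parity-injective-adjacent {zero}  {suc (suc _)} _         (s≤s ())  _
parity-injective-adjacent {suc zero}    {zero}  _         _         ()
parity-injective-adjacent {suc (suc _)} {zero}  (s≤s ())  _         _
parity-injective-adjacent {suc a} {suc b}       (s≤s a≤) (s≤s b≤) e = cong suc (parity-injective-adjacent a≤ b≤ (not-injective e))

module Layers {n} (G : Graph n) (conn : Connected G) (r : ℕ) (rad : IsRadius G (suc r)) where

  open Distance G conn

  c : Fin n
  c = proj₁ (proj₁ rad)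

  D : Fin n → ℕ
  D = dist c

  D≤1+r : ∀ x → D x ≤ suc r
  D≤1+r x = proj₁ (proj₂ (proj₁ rad)) x (D x) (dist-isDist c x)

  t : Fin n
  t = proj₁ (proj₂ (proj₂ (proj₁ rad)))

  Dt≡1+r : D t ≡ suc r
  Dt≡1+r = sym (IsDist⇒≡dist (proj₂ (proj₂ (proj₂ (proj₁ rad)))))

  HasSuccessor : ℕ → Fin n → Set
  HasSuccessor i x = D x ≡ i × ∃ λ s → adj G x s ≡ true × D s ≡ suc i

  hasSuccessor? : ∀ i x → Dec (HasSuccessor i x)
  hasSuccessor? i x = (D x ℕ.≟ i) ×-dec any? (λ s → (adj G x s Bool.≟ true) ×-dec (D s ℕ.≟ suc i))

  ancestor : ∀ i k {w} → D w ≡ suc (i + k) → ∃ λ u → HasSuccessor i u × Walk G u w (suc k)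
  ancestor i zero {w} Dw with dist-pred c Dw
  ... | u , e , Du = u , (trans Du (+-identityʳ i) , w , e , trans Dw (cong suc (+-identityʳ i))) , step e here
  ancestor i (suc k) Dw with dist-pred c (trans Dw (cong suc (+-suc i k)))
  ... | y , e , Dy with ancestor i k Dy
  ...   | u , u↑ , W = u , u↑ , _▷_ G W e

  hasSuccessor-exists : ∀ i → i < suc r → ∃ (HasSuccessor i)
  hasSuccessor-exists i (s≤s i≤r) with m≤n⇒∃[o]m+o≡n i≤r
  ... | k , i+k≡r with ancestor i k (trans Dt≡1+r (cong suc (sym i+k≡r)))
  ...   | u , u↑ , _ = u , u↑

  Dominated : ℕ → Fin n → Set
  Dominated i z = ∀ w → D w ≡ i → w ≢ z → adj G z w ≡ true × ¬ HasSuccessor i w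

  -- A vertex beyond layer i + 1 descends from a vertex of layer i + 1 with a successor, which must be z.
  dominated⇒close : ∀ {i z z′} → suc i < suc r → Dominated (suc i) z → adj G c z′ ≡ true → Walk G z′ z i →
    ∀ w → ∃ λ k → Walk G z′ w k × k < suc r
  dominated⇒close {i} {z} {z′} 1+i<1+r dominated c~z′ z′⇝z w with <-cmp (D w) (suc i)
  ... | tri< Dw<1+i _ _ =
    suc (D w) , step (trans (Graph.sym G z′ c) c~z′) (shortestWalk c w) , ≤-trans (s≤s Dw<1+i) 1+i<1+r
  ... | tri≈ _ Dw≡1+i _ with w ≟ z
  ...   | yes refl = i , z′⇝z , <⇒≤ 1+i<1+r
  ...   | no  w≢z  = suc i , _▷_ G z′⇝z (proj₁ (dominated w Dw≡1+i w≢z)) , 1+i<1+r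
  dominated⇒close {i} {z} {z′} 1+i<1+r dominated c~z′ z′⇝z w | tri> _ _ 1+i<Dw with m≤n⇒∃[o]m+o≡n 1+i<Dw
  ... | k , Dw≡ with ancestor (suc i) k (sym Dw≡)
  ...   | u , u↑ , u⇝w with u ≟ z
  ...     | no  u≢z  = contradiction u↑ (proj₂ (dominated u (proj₁ u↑) u≢z))
  ...     | yes refl = i + suc k , (_++ʷ_ G z′⇝z u⇝w) ,
                       subst (_≤ suc r) (trans (sym Dw≡) (cong suc (sym (+-suc i k)))) (D≤1+r w)

  dominated-impossible : ∀ {i z} → suc i < suc r → HasSuccessor (suc i) z → ¬ Dominated (suc i) z
  dominated-impossible {i} {z} 1+i<1+r (Dz , _) dominated with subst (Walk G c z) Dz (shortestWalk c z)
  ... | step {w = z′} c~z′ z′⇝z with farVertex rad z′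
  ...   | w , 1+r≤d with dominated⇒close 1+i<1+r dominated c~z′ z′⇝z w
  ...     | k , W , k<1+r = <⇒≱ k<1+r (≤-trans 1+r≤d (dist-minimal W))

  layerPair : ∀ i → suc i < suc r → ∃₂ λ a b → D a ≡ suc i × D b ≡ suc i × a ≢ b ×
    (adj G a b ≡ true → HasSuccessor (suc i) a × HasSuccessor (suc i) b)
  layerPair i 1+i<1+r with hasSuccessor-exists (suc i) 1+i<1+r
  ... | z , z↑ with any? (λ w → (D w ℕ.≟ suc i) ×-dec ¬? (w ≟ z)
                                  ×-dec ((adj G z w Bool.≟ true) →-dec hasSuccessor? (suc i) w))
  ...   | yes (w , Dw , w≢z , w↑) = z , w , proj₁ z↑ , Dw , w≢z ∘ sym , λ z~w → z↑ , w↑ z~w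
  ...   | no  none = contradiction dominated (dominated-impossible 1+i<1+r z↑)
    where
    dominated : Dominated (suc i) z
    dominated w Dw w≢z with adj G z w in z~w
    ... | true  = refl , λ w↑ → none (w , Dw , w≢z , λ _ → w↑)
    ... | false = contradiction (w , Dw , w≢z , λ z~w′ → contradiction (trans (sym z~w) z~w′) λ ()) none

  -- The picked vertices of layer i: only c (as a) in layer 0, only t (as b) in layer 1 + r.
  record Representatives (i : ℕ) : Set where
    field
      a b          : Fin n
      a-layer      : i < suc r → D a ≡ i
      b-layer      : 0 < i → i ≤ suc r → D b ≡ i
      a≢b          : 0 < i → i < suc r → a ≢ b
      a~b⇒a↑×b↑    : 0 < i → i < suc r → adj G a b ≡ true → HasSuccessor i a × HasSuccessor i b

  representatives : ∀ i → Representatives i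
  representatives zero = record
    { a = c ; b = c ; a-layer = λ _ → dist-refl c ; b-layer = λ () ; a≢b = λ () ; a~b⇒a↑×b↑ = λ () }
  representatives (suc i) with suc i <? suc r
  ... | yes 1+i<1+r = let (a , b , Da , Db , a≢b , a~b⇒) = layerPair i 1+i<1+r in record
    { a = a ; b = b ; a-layer = λ _ → Da ; b-layer = λ _ _ → Db
    ; a≢b = λ _ _ → a≢b ; a~b⇒a↑×b↑ = λ _ _ → a~b⇒ }
  ... | no  1+i≮1+r = record
    { a = t ; b = t
    ; a-layer = λ 1+i<1+r → contradiction 1+i<1+r 1+i≮1+r
    ; b-layer = λ _ 1+i≤1+r → trans Dt≡1+r (≤-antisym (≮⇒≥ 1+i≮1+r) 1+i≤1+r)
    ; a≢b = λ _ 1+i<1+r → contradiction 1+i<1+r 1+i≮1+r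
    ; a~b⇒a↑×b↑ = λ _ 1+i<1+r → contradiction 1+i<1+r 1+i≮1+r
    }

  module R (i : ℕ) = Representatives (representatives i)

  Selected : ℕ → Fin n → Set
  Selected i x = (i < suc r × x ≡ R.a i) ⊎ (0 < i × x ≡ R.b i)

  selected? : ∀ i x → Dec (Selected i x)
  selected? i x = ((i <? suc r) ×-dec (x ≟ R.a i)) ⊎-dec ((0 <? i) ×-dec (x ≟ R.b i))

  selected-pair : ∀ {i x y} → Selected i x → Selected i y → x ≢ y → 0 < i × i < suc r
  selected-pair (inj₁ (_ , refl))   (inj₁ (_ , refl))   x≢y = contradiction refl x≢y
  selected-pair (inj₁ (i< , refl))  (inj₂ (0< , refl))  _   = 0< , i<
  selected-pair (inj₂ (0< , refl))  (inj₁ (i< , refl))  _   = 0< , i<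
  selected-pair (inj₂ (_ , refl))   (inj₂ (_ , refl))   x≢y = contradiction refl x≢y

  selected-partner-unique : ∀ {i x y z} → Selected i x → Selected i y → Selected i z → x ≢ y → x ≢ z → y ≡ z
  selected-partner-unique (inj₁ (_ , refl)) (inj₁ (_ , refl)) _                 x≢y _   = contradiction refl x≢y
  selected-partner-unique (inj₁ (_ , refl)) (inj₂ (_ , refl)) (inj₁ (_ , refl)) _   x≢z = contradiction refl x≢z
  selected-partner-unique (inj₁ (_ , refl)) (inj₂ (_ , refl)) (inj₂ (_ , refl)) _   _   = refl
  selected-partner-unique (inj₂ (_ , refl)) (inj₂ (_ , refl)) _                 x≢y _   = contradiction refl x≢y
  selected-partner-unique (inj₂ (_ , refl)) (inj₁ (_ , refl)) (inj₂ (_ , refl)) _   x≢z = contradiction refl x≢z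
  selected-partner-unique (inj₂ (_ , refl)) (inj₁ (_ , refl)) (inj₁ (_ , refl)) _   _   = refl

  adj⇒≢ : ∀ {x y} → adj G x y ≡ true → x ≢ y
  adj⇒≢ {x} x~y refl = contradiction (trans (sym (irrefl G x)) x~y) λ ()

  selected-adj⇒hasSuccessor : ∀ {i x y} → Selected i x → Selected i y → adj G x y ≡ true → HasSuccessor i x
  selected-adj⇒hasSuccessor sx@(inj₁ (_ , refl)) sy@(inj₂ (_ , refl)) x~y =
    let (0<i , i<) = selected-pair sx sy (adj⇒≢ x~y) in proj₁ (R.a~b⇒a↑×b↑ _ 0<i i< x~y)
  selected-adj⇒hasSuccessor sx@(inj₂ (_ , refl)) sy@(inj₁ (_ , refl)) x~y =
    let (0<i , i<) = selected-pair sx sy (adj⇒≢ x~y)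
    in proj₂ (R.a~b⇒a↑×b↑ _ 0<i i< (trans (Graph.sym G _ _) x~y))
  selected-adj⇒hasSuccessor (inj₁ (_ , refl)) (inj₁ (_ , refl)) x~y = contradiction refl (adj⇒≢ x~y)
  selected-adj⇒hasSuccessor (inj₂ (_ , refl)) (inj₂ (_ , refl)) x~y = contradiction refl (adj⇒≢ x~y)

  colour : Fin n → Maybe Bool
  colour x with selected? (D x) x
  ... | yes _ = just (parity (D x))
  ... | no  _ = nothing

  colour≡just : ∀ {x p} → colour x ≡ just p → Selected (D x) x × parity (D x) ≡ p
  colour≡just {x} e with selected? (D x) x
  colour≡just refl | yes sx = sx , refl
  colour≡just ()   | no  _

  selected-colour : ∀ {i x} → D x ≡ i → Selected i x → colour x ≡ just (parity i)
  selected-colour {x = x} refl sx with selected? (D x) x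
  ... | yes _   = refl
  ... | no  ¬sx = contradiction sx ¬sx

  -- Of the layers j and j+1 exactly one has parity p; pick its representative a or b accordingly.
  pick : Bool → ℕ → Fin n
  pick p j with parity j Bool.≟ p
  ... | yes _ = R.a j
  ... | no  _ = R.b (suc j)

  pick-colour : ∀ p {j} → j < suc r → colour (pick p j) ≡ just p
  pick-colour p {j} j< with parity j Bool.≟ p
  ... | yes pj≡p = trans (selected-colour (R.a-layer j j<) (inj₁ (j< , refl))) (cong just pj≡p)
  ... | no  pj≢p = trans (selected-colour (R.b-layer (suc j) z<s j<) (inj₂ (z<s , refl)))
                         (cong just (sym (¬-not (pj≢p ∘ sym))))

  a≢b-next : ∀ {j k} → j < suc r → k < suc r → R.a j ≢ R.b (suc k)
  a≢b-next {j} {k} j< k< aj≡bk+1 =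
    R.a≢b j (subst (0 <_) (sym j≡k+1) z<s) j< (trans aj≡bk+1 (cong R.b (sym j≡k+1)))
    where
    j≡k+1 : j ≡ suc k
    j≡k+1 = trans (sym (R.a-layer j j<)) (trans (cong D aj≡bk+1) (R.b-layer (suc k) z<s k<))

  pick-injective : ∀ p {j k} → j < suc r → k < suc r → pick p j ≡ pick p k → j ≡ k
  pick-injective p {j} {k} j< k< e with parity j Bool.≟ p | parity k Bool.≟ p
  ... | yes _ | yes _ = trans (sym (R.a-layer j j<)) (trans (cong D e) (R.a-layer k k<))
  ... | no  _ | no  _ = suc-injective (trans (sym (R.b-layer (suc j) z<s j<)) (trans (cong D e) (R.b-layer (suc k) z<s k<)))
  ... | yes _ | no  _ = contradiction e (a≢b-next j< k<)
  ... | no  _ | yes _ = contradiction (sym e) (a≢b-next k< j<)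

  class-size : ∀ p → suc r ≤ ∣ colourClass colour p ∣
  class-size p = injection⇒≤∣p∣ (colourClass colour p) (pick p ∘ toℕ)
    (λ j k e → toℕ-injective (pick-injective p (toℕ<n j) (toℕ<n k) e))
    (λ j → ∈-tabulate⁺ (≡just⇒hasColour colour (pick-colour p (toℕ<n j))))

  otherLayerNeighbour : ∀ {x} i → D x ≡ i → ∃ λ w → adj G x w ≡ true × D w ≢ i
  otherLayerNeighbour {x} (suc i) Dx with dist-pred c Dx
  ... | q , q~x , Dq = q , trans (Graph.sym G x q) q~x , λ Dq≡ → 1+n≢n (trans (sym Dq≡) Dq)
  otherLayerNeighbour {x} zero Dx with hasSuccessor-exists 0 z<s
  ... | u , Du , s , u~s , Ds = s , subst (λ v → adj G v s ≡ true) (trans (sym (dist≡0 Du)) (dist≡0 Dx)) u~s ,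
                                λ Ds≡0 → 1+n≢n (trans (sym Ds) Ds≡0)

  predecessor : ∀ {x} → 0 < D x → ∃ λ q → adj G x q ≡ true × suc (D q) ≡ D x
  predecessor {x} 0<Dx with m≤n⇒∃[o]m+o≡n 0<Dx
  ... | i , 1+i≡Dx with dist-pred c (sym 1+i≡Dx)
  ...   | q , q~x , Dq = q , trans (Graph.sym G x q) q~x , trans (cong suc Dq) 1+i≡Dx

  classNeighbour : ∀ {x p w} → parity (D x) ≡ p → adj G x w ≡ true → w ∈ colourClass colour p →
    Selected (D x) w × D w ≡ D x
  classNeighbour {x} {p} {w} px x~w w∈ =
    let (sw , pw) = colour≡just (hasColour⇒≡just colour (∈-tabulate⁻ w∈))
        Dw≡Dx     = parity-injective-adjacent (dist-adj c x~w) (dist-adj c (trans (Graph.sym G w x) x~w))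
                                              (trans pw (sym px))
    in subst (λ i → Selected i w) Dw≡Dx sw , Dw≡Dx

  sameColourNeighbour : ∀ {x p y} → parity (D x) ≡ p → y ∈ nbhd (adj G) x ∩ colourClass colour p →
    adj G x y ≡ true × Selected (D x) y
  sameColourNeighbour {x} {p} px y∈ =
    let (y∈N , y∈C) = x∈p∩q⁻ (nbhd (adj G) x) (colourClass colour p) y∈
        x~y         = ∈-tabulate⁻ y∈N
    in x~y , proj₁ (classNeighbour px x~y y∈C)

  otherLayer⇒outsideClass : ∀ {x p w} → parity (D x) ≡ p → adj G x w ≡ true → D w ≢ D x →
    w ∈ nbhd (adj G) x ∩ ∁ (colourClass colour p)
  otherLayer⇒outsideClass px x~w Dw≢Dx =
    x∈p∩q⁺ (∈-tabulate⁺ x~w , x∉p⇒x∈∁p (λ w∈ → Dw≢Dx (proj₂ (classNeighbour px x~w w∈))))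

  sameColourNeighbours⊆⁅y⁆ : ∀ {x p y} → Selected (D x) x → parity (D x) ≡ p →
    y ∈ nbhd (adj G) x ∩ colourClass colour p → nbhd (adj G) x ∩ colourClass colour p ⊆ ⁅ y ⁆
  sameColourNeighbours⊆⁅y⁆ {y = y} sx px y∈ z∈ =
    let (x~y , sy) = sameColourNeighbour px y∈
        (x~z , sz) = sameColourNeighbour px z∈
    in subst (_∈ ⁅ y ⁆) (selected-partner-unique sx sy sz (adj⇒≢ x~y) (adj⇒≢ x~z)) (x∈⁅x⁆ y)

  predecessor-successor⇒2≤δ : ∀ {x p} → parity (D x) ≡ p → 0 < D x → HasSuccessor (D x) x →
    2 ≤ δ (adj G) (∁ (colourClass colour p)) x
  predecessor-successor⇒2≤δ px 0<Dx (_ , s , x~s , Ds) with predecessor 0<Dx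
  ... | q , x~q , Dq = x,y∈p⇒2≤∣p∣ (otherLayer⇒outsideClass px x~q (λ Dq≡Dx → 1+n≢n (trans Dq (sym Dq≡Dx))))
                                   (otherLayer⇒outsideClass px x~s (λ Ds≡Dx → 1+n≢n (trans (sym Ds) Ds≡Dx)))
                                   (λ q≡s → <⇒≢ (m<n⇒m<1+n (n<1+n _)) (trans (cong D q≡s) (trans Ds (cong suc (sym Dq)))))

  outnumbered : ∀ x p → colour x ≡ just p →
    suc (δ (adj G) (colourClass colour p) x) ≤ δ (adj G) (∁ (colourClass colour p)) x
  outnumbered x p cx with colour≡just cx | nonempty? (nbhd (adj G) x ∩ colourClass colour p)
  ... | _ , px | no ∅ =
    let (w , x~w , Dw≢Dx) = otherLayerNeighbour (D x) refl in
    subst (λ k → suc k ≤ δ (adj G) (∁ (colourClass colour p)) x) (sym (Empty⇒∣p∣≡0 ∅))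
          (x∈p⇒1≤∣p∣ (otherLayer⇒outsideClass px x~w Dw≢Dx))
  ... | sx , px | yes (y , y∈) =
    let (x~y , sy) = sameColourNeighbour px y∈ in
    ≤-trans (s≤s (⊆⁅x⁆⇒∣p∣≤1 (sameColourNeighbours⊆⁅y⁆ sx px y∈)))
            (predecessor-successor⇒2≤δ px (proj₁ (selected-pair sx sy (adj⇒≢ x~y)))
                                          (selected-adj⇒hasSuccessor sx sy x~y))

  colouring : OffensiveColouring G (suc r)
  colouring = record { colour = colour ; class-size = class-size ; outnumbered = outnumbered }

offensiveColouring : ∀ {n} (G : Graph n) → Connected G → ∀ r → IsRadius G r → OffensiveColouring G r
offensiveColouring G conn zero    rad =
  record { colour = λ _ → nothing ; class-size = λ _ → z≤n ; outnumbered = λ _ _ () }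
offensiveColouring G conn (suc r) rad = Layers.colouring G conn r rad

proposition8 : ∀ {n₁ n₂} (G : Graph n₁) (H : Graph n₂) → Connected G → Connected H →
    ∀ rG rH → IsRadius G rG → IsRadius H rH →
    ∃ λ (S : Subset (n₁ * n₂)) → IsGOA (□-adj G H) S × ∣ S ∣ + 2 * rG * rH ≤ n₁ * n₂
proposition8 G H connG connH rG rH radG radH =
  offensiveColouring⇒GOA (offensiveColouring G connG rG radG) (offensiveColouring H connH rH radH)
    (combine (proj₁ (proj₁ radG)) (proj₁ (proj₁ radH)))
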